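{- Let $G$ be a tree obtained from a subdivision of a star by adding any number (possibly zero) of pendent vertices adjacent to each leaf of that subdivision. Then $\pi_f(G)\le\frac43$.
   Context: A subdivision of a star $K_{1,k}$ is obtained by replacing each edge of $K_{1,k}$ by a path (of length at least $1$) with new internal vertices. Two edges are nonincident if they share no endpoint. A linear ordering of $V(G)$ separates a pair of nonincident edges if both endpoints of one edge precede both endpoints of the other. $\pi_t(G)$ is the minimum length of a list of linear orderings of $V(G)$ (repetitions allowed) separating every pair of nonincident edges at least $t$ times ($0$ if there are no such pairs), and $\pi_f(G)=\liminf_{t\to\infty}\pi_t(G)/t$. -}

module Defs where

open import Data.Nat using (ℕ; zero; suc; _+_; _*_; _≤_; _<_; _<ᵇ_)
open import Data.Fin using (Fin; toℕ; inject₁; fromℕ)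
import Data.Fin as F
open import Data.Fin.Permutation using (Permutation′; _⟨$⟩ʳ_)
open import Data.Bool using (Bool; true; false; _∧_; _∨_; if_then_else_)
open import Data.List using (List; []; _∷_; length)
open import Data.Sum using (_⊎_)
open import Data.Product using (Σ; _×_; ∃-syntax)
open import Relation.Binary.PropositionalEquality using (_≡_; _≢_)
open import Function.Bundles using (_↔_; Inverse; _⇔_)

-- A subdivision of the star K_{1,k}: a centre and k legs; leg i is a path
-- of length  suc (legs i) ≥ 1  from the centre.  Vertex  leg i j  is the
-- vertex at distance  j+1  from the centre on leg i, so  leg i (fromℕ (legs i))
-- is the leaf of leg i.

data SV (k : ℕ) (legs pend : Fin k → ℕ) : Set where
  centre  : SV k legs pend
  leg     : (i : Fin k) → Fin (suc (legs i)) → SV k legs pend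
  pendant : (i : Fin k) → Fin (pend i) → SV k legs pend

data Step (k : ℕ) (legs pend : Fin k → ℕ) : SV k legs pend → SV k legs pend → Set where
  centre-leg : (i : Fin k) → Step k legs pend centre (leg i F.zero)
  leg-leg    : (i : Fin k) (j : Fin (legs i)) →
               Step k legs pend (leg i (inject₁ j)) (leg i (F.suc j))
  leg-pend   : (i : Fin k) (q : Fin (pend i)) →
               Step k legs pend (leg i (fromℕ (legs i))) (pendant i q)

SAdj : (k : ℕ) (legs pend : Fin k → ℕ) → SV k legs pend → SV k legs pend → Set
SAdj k legs pend u v = Step k legs pend u v ⊎ Step k legs pend v u

IsoToSpider : {n : ℕ} (Adj : Fin n → Fin n → Set)
              (k : ℕ) (legs pend : Fin k → ℕ) → Set
IsoToSpider {n} Adj k legs pend =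
  Σ (Fin n ↔ SV k legs pend) λ f →
    ∀ u v → Adj u v ⇔ SAdj k legs pend (Inverse.to f u) (Inverse.to f v)

-- Linear orderings of V(G) = Fin n: a permutation σ, vertex v sits at
-- position  σ ⟨$⟩ʳ v.

before : {n : ℕ} → Permutation′ n → Fin n → Fin n → Bool
before σ u v = toℕ (σ ⟨$⟩ʳ u) <ᵇ toℕ (σ ⟨$⟩ʳ v)

separates : {n : ℕ} → Permutation′ n → Fin n → Fin n → Fin n → Fin n → Bool
separates σ a b c d =
  (before σ a c ∧ before σ a d ∧ before σ b c ∧ before σ b d) ∨
  (before σ c a ∧ before σ c b ∧ before σ d a ∧ before σ d b)

sepCount : {n : ℕ} → List (Permutation′ n) → Fin n → Fin n → Fin n → Fin n → ℕ
sepCount []      a b c d = 0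
sepCount (σ ∷ L) a b c d =
  (if separates σ a b c d then 1 else 0) + sepCount L a b c d

SeparatesAll : {n : ℕ} (Adj : Fin n → Fin n → Set) → ℕ → List (Permutation′ n) → Set
SeparatesAll Adj t L =
  ∀ a b c d → Adj a b → Adj c d →
  a ≢ c → a ≢ d → b ≢ c → b ≢ d →
  t ≤ sepCount L a b c d

PiLe : {n : ℕ} (Adj : Fin n → Fin n → Set) → ℕ → ℕ → Set
PiLe {n} Adj t k =
  Σ (List (Permutation′ n)) λ L → length L ≡ k × SeparatesAll Adj t L

-- π_f(G) = liminf_t π_t(G)/t ≤ 4/3, i.e.
-- for every ε = 1/m (m ≥ 1) and every N there is t ≥ N with
-- π_t(G)/t < 4/3 + 1/m, i.e.  3m·π_t(G) < (4m+3)·t.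
PiFracLe4/3 : {n : ℕ} (Adj : Fin n → Fin n → Set) → Set
PiFracLe4/3 Adj =
  ∀ (m : ℕ) → 1 ≤ m → ∀ (N : ℕ) →
  ∃[ t ] (N ≤ t × ∃[ k ] (PiLe Adj t k × 3 * m * k < (4 * m + 3) * t))

-- For a sign vector s ∈ {0,1}^k, order the vertices as follows: the legs i with s i = 1 come
-- after the centre, in increasing order of i, each traversed outwards from the centre; the legs
-- with s i = 0 come before it, in increasing order of i, each traversed inwards towards the
-- centre (pendant vertices go with the leaf of their leg). Two nonincident edges on one leg, or
-- on different legs away from the centre, are separated by every such ordering. A spoke
-- centre–(i,1) and an edge on another leg j fail to be separated only when s i = s j and leg j
-- lies between leg i and the centre, which happens for a quarter of the sign vectors. So the
-- 2^k orderings separate every pair at least (3/4)·2^k times, and repeating them gives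
-- π_t ≤ 4t/3 for arbitrarily large t.

module Submission where

open import Defs
open import Data.Bool using (Bool; true; false; _∧_; _∨_; _xor_; T; if_then_else_)
open import Data.Bool.Properties using (T-∧; T-∨; ∨-comm)
open import Data.Empty using (⊥-elim)
open import Data.Fin using (Fin; zero; suc; toℕ; fromℕ; fromℕ<; inject₁; punchOut; _≟_)
open import Data.Fin.Permutation using (Permutation′; _⟨$⟩ʳ_)
open import Data.Fin.Properties
  using (toℕ-injective; toℕ<n; toℕ-fromℕ<; toℕ-inject₁; toℕ-fromℕ; toℕ≤pred[n]; nonZeroIndex;
         any?; punchOut-injective; injective⇒≤)
open import Data.List using (List; []; _∷_; [_]; _++_; map; concat; replicate; length; allFin)
open import Data.List.Membership.Propositional using (_∈_)
open import Data.List.Membership.Propositional.Properties using (∈-allFin)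
open import Data.List.Properties using (length-map; length-tabulate)
open import Data.List.Relation.Unary.Any using (here; there)
open import Data.Nat using (ℕ; NonZero; zero; suc; _+_; _*_; _⊔_; _^_; _∸_; _≤_; _<_; _<ᵇ_; z≤n; s≤s; z<s)
open import Data.Nat.DivMod using (_%_; [m+kn]%n≡m%n; m<n⇒m%n≡m)
open import Data.Nat.Properties hiding (_≟_)
open import Data.Nat.Tactic.RingSolver using (solve-∀)
open import Data.Product using (Σ; _×_; _,_; proj₁; proj₂; ∃-syntax)
open import Data.Sum using (_⊎_; inj₁; inj₂)
open import Data.Vec.Functional as Vector using (Vector)
open import Function using (_∘_; id)
open import Function.Bundles using (Inverse; Equivalence; Injection; mk⤖)
open import Function.Consequences.Propositional using (strictlySurjective⇒surjective)
open import Function.Definitions using (Injective; StrictlySurjective)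
open import Function.Properties.Bijection using (⤖⇒↔)
open import Function.Properties.Inverse using (↔⇒↣)
open import Relation.Binary.Definitions using (tri<; tri≈; tri>)
open import Relation.Binary.PropositionalEquality hiding ([_])
open import Relation.Nullary using (¬_; yes; no)
open import Relation.Nullary.Reflects using (ofʸ; ofⁿ)

count : {A : Set} → (A → Bool) → List A → ℕ
count p []       = 0
count p (x ∷ xs) = (if p x then 1 else 0) + count p xs

module _ {A : Set} where

  count-++ : (p : A → Bool) (xs ys : List A) → count p (xs ++ ys) ≡ count p xs + count p ys
  count-++ p []       ys = refl
  count-++ p (x ∷ xs) ys =
    trans (cong (_ +_) (count-++ p xs ys)) (sym (+-assoc (if p x then 1 else 0) (count p xs) (count p ys)))

  count-map : {B : Set} (p : B → Bool) (f : A → B) (xs : List A) → count p (map f xs) ≡ count (p ∘ f) xs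
  count-map p f []       = refl
  count-map p f (x ∷ xs) = cong (_ +_) (count-map p f xs)

  count-cong : {p q : A → Bool} → (∀ x → p x ≡ q x) → (xs : List A) → count p xs ≡ count q xs
  count-cong p≗q []       = refl
  count-cong p≗q (x ∷ xs) = cong₂ _+_ (cong (λ b → if b then 1 else 0) (p≗q x)) (count-cong p≗q xs)

  count-true : (xs : List A) → count (λ _ → true) xs ≡ length xs
  count-true []       = refl
  count-true (x ∷ xs) = cong suc (count-true xs)

  count-false : (xs : List A) → count (λ _ → false) xs ≡ 0
  count-false []       = refl
  count-false (x ∷ xs) = count-false xs

  count-concat-replicate : (p : A → Bool) (r : ℕ) (xs : List A) →
                           count p (concat (replicate r xs)) ≡ r * count p xs
  count-concat-replicate p zero    xs = refl
  count-concat-replicate p (suc r) xs =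
    trans (count-++ p xs _) (cong (count p xs +_) (count-concat-replicate p r xs))

  private
    indicator-mono : ∀ {a b} → (T a → T b) → (if a then 1 else 0) ≤ (if b then 1 else 0)
    indicator-mono {false}         _   = z≤n
    indicator-mono {true}  {true}  _   = ≤-refl
    indicator-mono {true}  {false} a⇒b = ⊥-elim (a⇒b _)

    indicator-< : ∀ {a b} → ¬ T a → T b → (if a then 1 else 0) < (if b then 1 else 0)
    indicator-< {false} {true}  _  _ = z<s
    indicator-< {true}          ¬a _ = ⊥-elim (¬a _)

  count-mono : {p q : A → Bool} → (∀ x → T (p x) → T (q x)) → (xs : List A) → count p xs ≤ count q xs
  count-mono p⇒q []       = z≤n
  count-mono p⇒q (x ∷ xs) = +-mono-≤ (indicator-mono (p⇒q x)) (count-mono p⇒q xs)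

  count-mono-< : {p q : A → Bool} → (∀ x → T (p x) → T (q x)) →
                 ∀ {x xs} → x ∈ xs → ¬ T (p x) → T (q x) → count p xs < count q xs
  count-mono-< p⇒q {xs = _ ∷ xs} (here refl) ¬px qx = +-mono-<-≤ (indicator-< ¬px qx) (count-mono p⇒q xs)
  count-mono-< p⇒q {xs = y ∷ _}  (there x∈) ¬px qx =
    +-mono-≤-< (indicator-mono (p⇒q y)) (count-mono-< p⇒q x∈ ¬px qx)

  count-<-length : {p : A → Bool} → ∀ {x xs} → x ∈ xs → ¬ T (p x) → count p xs < length xs
  count-<-length {p} {xs = xs} x∈ ¬px =
    subst (count p xs <_) (count-true xs) (count-mono-< (λ _ _ → _) x∈ ¬px _)

signs : (k : ℕ) → List (Vector Bool k)
signs zero    = [ (λ ()) ]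
signs (suc k) = map (false Vector.∷_) (signs k) ++ map (true Vector.∷_) (signs k)

count-signs-suc : ∀ k (p : Vector Bool (suc k) → Bool) →
                  count p (signs (suc k)) ≡
                  count (λ s → p (false Vector.∷ s)) (signs k) + count (λ s → p (true Vector.∷ s)) (signs k)
count-signs-suc k p =
  trans (count-++ p (map _ (signs k)) _) (cong₂ _+_ (count-map p _ (signs k)) (count-map p _ (signs k)))

count-signs-true : ∀ k → count (λ _ → true) (signs k) ≡ 2 ^ k
count-signs-true zero    = refl
count-signs-true (suc k) =
  trans (count-signs-suc k (λ _ → true)) (cong₂ _+_ ih (trans ih (sym (+-identityʳ _))))
  where
  ih : count (λ _ → true) (signs k) ≡ 2 ^ k
  ih = count-signs-true k

length-signs : ∀ k → length (signs k) ≡ 2 ^ k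
length-signs k = trans (sym (count-true (signs k))) (count-signs-true k)

private
  halves : ∀ m c {x} → m * c ≡ x → m * (c + c) ≡ 2 * x
  halves m c refl = trans (*-distribˡ-+ m c c) (cong (m * c +_) (sym (+-identityʳ _)))

count-coordinate : ∀ k (i : Fin k) b → 2 * count (λ s → s i xor b) (signs k) ≡ 2 ^ k
count-coordinate (suc k) zero true =
  cong (2 *_) (trans (count-signs-suc k (λ s → s zero xor true))
                     (trans (cong₂ _+_ (count-signs-true k) (count-false (signs k))) (+-identityʳ _)))
count-coordinate (suc k) zero false =
  cong (2 *_) (trans (count-signs-suc k (λ s → s zero xor false))
                     (cong₂ _+_ (count-false (signs k)) (count-signs-true k)))
count-coordinate (suc k) (suc i) b =
  trans (cong (2 *_) (count-signs-suc k (λ s → s (suc i) xor b)))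
        (halves 2 (count (λ s → s i xor b) (signs k)) (count-coordinate k i b))

private
  quarters : ∀ x c → 2 * c ≡ x → 4 * (x + c) ≡ 3 * (2 * x)
  quarters _ c refl = identity c
    where
    identity : ∀ c → 4 * (2 * c + c) ≡ 3 * (2 * (2 * c))
    identity = solve-∀

  swap-factors : ∀ x → 2 * (3 * x) ≡ 3 * (2 * x)
  swap-factors = solve-∀

count-first-two-coordinates : ∀ k (j : Fin k) b b' →
  4 * count (λ s → (s zero xor b) ∨ (s (suc j) xor b')) (signs (suc k)) ≡ 3 * 2 ^ suc k
count-first-two-coordinates k j true b' =
  trans (cong (4 *_) (trans (count-signs-suc k (λ s → (s zero xor true) ∨ (s (suc j) xor b')))
                            (cong (_+ c) (count-signs-true k))))
        (quarters (2 ^ k) c (count-coordinate k j b'))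
  where
  c : ℕ
  c = count (λ s → s j xor b') (signs k)
count-first-two-coordinates k j false b' =
  trans (cong (4 *_) (trans (count-signs-suc k (λ s → (s zero xor false) ∨ (s (suc j) xor b')))
                            (trans (cong (c +_) (count-signs-true k)) (+-comm c (2 ^ k)))))
        (quarters (2 ^ k) c (count-coordinate k j b'))
  where
  c : ℕ
  c = count (λ s → s j xor b') (signs k)

count-two-coordinates : ∀ k {i j : Fin k} → i ≢ j → ∀ b b' →
                        4 * count (λ s → (s i xor b) ∨ (s j xor b')) (signs k) ≡ 3 * 2 ^ k
count-two-coordinates (suc k) {zero}  {zero}  i≢j _ _  = ⊥-elim (i≢j refl)
count-two-coordinates (suc k) {zero}  {suc j} _   b b' = count-first-two-coordinates k j b b'
count-two-coordinates (suc k) {suc i} {zero}  _   b b' =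
  trans (cong (4 *_) (count-cong (λ s → ∨-comm (s (suc i) xor b) (s zero xor b')) (signs (suc k))))
        (count-first-two-coordinates k i b' b)
count-two-coordinates (suc k) {suc i} {suc j} i≢j b b' =
  trans (cong (4 *_) (count-signs-suc k (λ s → (s (suc i) xor b) ∨ (s (suc j) xor b'))))
        (trans (halves 4 (count (λ s → (s i xor b) ∨ (s j xor b')) (signs k))
                         (count-two-coordinates k (i≢j ∘ cong suc) b b'))
               (swap-factors (2 ^ k)))

ThreeQuarters : ∀ {k} → (Vector Bool k → Bool) → Set
ThreeQuarters {k} good = 3 * 2 ^ k ≤ 4 * count good (signs k)

ThreeQuarters-all : ∀ {k} → ThreeQuarters {k} (λ _ → true)
ThreeQuarters-all {k} = subst (λ c → 3 * 2 ^ k ≤ 4 * c) (sym (count-signs-true k)) (*-monoˡ-≤ (2 ^ k) (n≤1+n 3))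

ThreeQuarters-two-coordinates : ∀ {k} {i j : Fin k} → i ≢ j → ∀ b b' →
                                ThreeQuarters (λ s → (s i xor b) ∨ (s j xor b'))
ThreeQuarters-two-coordinates {k} i≢j b b' = ≤-reflexive (sym (count-two-coordinates k i≢j b b'))

injective⇒strictlySurjective : ∀ {n} {f : Fin n → Fin n} → Injective _≡_ _≡_ f → StrictlySurjective _≡_ f
injective⇒strictlySurjective {suc n} {f} f-inj y with any? (λ x → f x ≟ y)
... | yes hit  = hit
... | no ¬hit = ⊥-elim (<-irrefl refl (injective⇒≤ punchOut-inj))
  where
  miss : ∀ x → y ≢ f x
  miss x y≡fx = ¬hit (x , sym y≡fx)

  punchOut-inj : Injective _≡_ _≡_ (λ x → punchOut (miss x))
  punchOut-inj {a} {b} eq = f-inj (punchOut-injective (miss a) (miss b) eq)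

OrdersBy : ∀ {n} → Permutation′ n → (Fin n → ℕ) → Set
OrdersBy σ κ = ∀ u v → κ u < κ v → toℕ (σ ⟨$⟩ʳ u) < toℕ (σ ⟨$⟩ʳ v)

module _ {n : ℕ} (κ : Fin n → ℕ) where

  private
    -- ties of κ are broken by the index
    κ′ : Fin n → ℕ
    κ′ u = toℕ u + κ u * n

    κ′-injective : Injective _≡_ _≡_ κ′
    κ′-injective {u} {v} eq = toℕ-injective (begin
      toℕ u      ≡⟨ sym (m<n⇒m%n≡m (toℕ<n u)) ⟩
      toℕ u % n  ≡⟨ sym ([m+kn]%n≡m%n (toℕ u) (κ u) n) ⟩
      κ′ u % n   ≡⟨ cong (_% n) eq ⟩
      κ′ v % n   ≡⟨ [m+kn]%n≡m%n (toℕ v) (κ v) n ⟩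
      toℕ v % n  ≡⟨ m<n⇒m%n≡m (toℕ<n v) ⟩
      toℕ v      ∎)
      where
      open ≡-Reasoning
      instance
        n≢0 : NonZero n
        n≢0 = nonZeroIndex u

    κ′-mono : ∀ {u v} → κ u < κ v → κ′ u < κ′ v
    κ′-mono {u} {v} κu<κv = begin-strict
      toℕ u + κ u * n  <⟨ +-monoˡ-< (κ u * n) (toℕ<n u) ⟩
      suc (κ u) * n    ≤⟨ *-monoˡ-≤ n κu<κv ⟩
      κ v * n          ≤⟨ m≤n+m (κ v * n) (toℕ v) ⟩
      κ′ v             ∎
      where open ≤-Reasoning

    rank : Fin n → ℕ
    rank u = count (λ v → κ′ v <ᵇ κ′ u) (allFin n)

    not-below-itself : ∀ u → ¬ T (κ′ u <ᵇ κ′ u)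
    not-below-itself u = <-irrefl refl ∘ <ᵇ⇒< (κ′ u) (κ′ u)

    rank<n : ∀ u → rank u < n
    rank<n u = subst (rank u <_) (length-tabulate id) (count-<-length (∈-allFin u) (not-below-itself u))

    rank-mono : ∀ {u v} → κ′ u < κ′ v → rank u < rank v
    rank-mono {u} {v} κ′u<κ′v =
      count-mono-< (λ x x<u → <⇒<ᵇ (<-trans (<ᵇ⇒< (κ′ x) (κ′ u) x<u) κ′u<κ′v))
                   (∈-allFin u) (not-below-itself u) (<⇒<ᵇ κ′u<κ′v)

    position : Fin n → Fin n
    position u = fromℕ< (rank<n u)

    position-mono : ∀ {u v} → κ′ u < κ′ v → toℕ (position u) < toℕ (position v)
    position-mono {u} {v} κ′u<κ′v =
      subst₂ _<_ (sym (toℕ-fromℕ< (rank<n u))) (sym (toℕ-fromℕ< (rank<n v))) (rank-mono κ′u<κ′v)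

    position-injective : Injective _≡_ _≡_ position
    position-injective {u} {v} eq with <-cmp (κ′ u) (κ′ v)
    ... | tri< lt _ _ = ⊥-elim (<-irrefl (cong toℕ eq) (position-mono lt))
    ... | tri≈ _ e _  = κ′-injective e
    ... | tri> _ _ gt = ⊥-elim (<-irrefl (cong toℕ (sym eq)) (position-mono gt))

  sortBy : Permutation′ n
  sortBy = ⤖⇒↔ (mk⤖ (position-injective ,
                      strictlySurjective⇒surjective (injective⇒strictlySurjective position-injective)))

  sortBy-orders : OrdersBy sortBy κ
  sortBy-orders u v κu<κv = position-mono (κ′-mono κu<κv)

record Below {A : Set} (κ : A → ℕ) (x y z w : A) : Set where
  constructor below
  field
    x<z : κ x < κ z
    x<w : κ x < κ w
    y<z : κ y < κ z
    y<w : κ y < κ w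

data Separated {A : Set} (κ : A → ℕ) (x y z w : A) : Set where
  ahead  : Below κ x y z w → Separated κ x y z w
  behind : Below κ z w x y → Separated κ x y z w

module _ {A : Set} {κ : A → ℕ} {x y z w : A} where

  Separated-swapˡ : Separated κ x y z w → Separated κ y x z w
  Separated-swapˡ (ahead  (below xz xw yz yw)) = ahead  (below yz yw xz xw)
  Separated-swapˡ (behind (below zx zy wx wy)) = behind (below zy zx wy wx)

  Separated-swapʳ : Separated κ x y z w → Separated κ x y w z
  Separated-swapʳ (ahead  (below xz xw yz yw)) = ahead  (below xw xz yw yz)
  Separated-swapʳ (behind (below zx zy wx wy)) = behind (below wx wy zx zy)

  Separated-sym : Separated κ x y z w → Separated κ z w x y
  Separated-sym (ahead  b) = behind b
  Separated-sym (behind b) = ahead  b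

Separated-∘ : ∀ {A B : Set} {κ : B → ℕ} (g : A → B) {a b c d} →
              Separated κ (g a) (g b) (g c) (g d) → Separated (κ ∘ g) a b c d
Separated-∘ g (ahead  (below ac ad bc bd)) = ahead  (below ac ad bc bd)
Separated-∘ g (behind (below ca cb da db)) = behind (below ca cb da db)

Oriented : Bool → ℕ → ℕ → Set
Oriented true  m n = m < n
Oriented false m n = n < m

Oriented-+ : ∀ b a {m n} → Oriented b m n → Oriented b (a + m) (a + n)
Oriented-+ true  a = +-monoʳ-< a
Oriented-+ false a = +-monoʳ-< a

separated-oriented : ∀ {A : Set} {κ : A → ℕ} {x y z w} b →
                     Oriented b (κ x) (κ z) → Oriented b (κ x) (κ w) →
                     Oriented b (κ y) (κ z) → Oriented b (κ y) (κ w) → Separated κ x y z w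
separated-oriented true  xz xw yz yw = ahead  (below xz xw yz yw)
separated-oriented false xz xw yz yw = behind (below xz yz xw yw)

separates-if-separated : ∀ {n} {σ : Permutation′ n} {κ} → OrdersBy σ κ →
                         ∀ {a b c d} → Separated κ a b c d → T (separates σ a b c d)
separates-if-separated {σ = σ} {κ} ordered separated =
  Equivalence.from T-∨ (either separated)
  where
  before-if-< : ∀ {u v} → κ u < κ v → T (before σ u v)
  before-if-< {u} {v} κu<κv = <⇒<ᵇ (ordered u v κu<κv)

  all-before : ∀ {x y z w} → Below κ x y z w →
               T (before σ x z ∧ before σ x w ∧ before σ y z ∧ before σ y w)
  all-before (below xz xw yz yw) =
    Equivalence.from T-∧ (before-if-< xz , Equivalence.from T-∧
      (before-if-< xw , Equivalence.from T-∧ (before-if-< yz , before-if-< yw)))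

  either : ∀ {a b c d} → Separated κ a b c d →
           T (before σ a c ∧ before σ a d ∧ before σ b c ∧ before σ b d) ⊎
           T (before σ c a ∧ before σ c b ∧ before σ d a ∧ before σ d b)
  either (ahead  b) = inj₁ (all-before b)
  either (behind b) = inj₂ (all-before b)

sepCount≡count : ∀ {n} (L : List (Permutation′ n)) a b c d →
                 sepCount L a b c d ≡ count (λ σ → separates σ a b c d) L
sepCount≡count []      a b c d = refl
sepCount≡count (σ ∷ L) a b c d = cong (_ +_) (sepCount≡count L a b c d)

count≤sepCount : ∀ {A : Set} {n} (σ : A → Permutation′ n) {good : A → Bool} {a b c d} →
                 (∀ x → T (good x) → T (separates (σ x) a b c d)) →
                 (xs : List A) → count good xs ≤ sepCount (map σ xs) a b c d
count≤sepCount σ {good} {a} {b} {c} {d} good⇒separates xs = begin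
  count good xs                                   ≤⟨ count-mono good⇒separates xs ⟩
  count (λ x → separates (σ x) a b c d) xs        ≡⟨ count-map (λ τ → separates τ a b c d) σ xs ⟨
  count (λ τ → separates τ a b c d) (map σ xs)   ≡⟨ sepCount≡count (map σ xs) a b c d ⟨
  sepCount (map σ xs) a b c d                     ∎
  where open ≤-Reasoning

-- The ratio 4/3 is attained exactly.
fractional-≤4/3 : ∀ {n} (Adj : Fin n → Fin n → Set) (L : List (Permutation′ n)) → 0 < length L →
                  (∀ a b c d → Adj a b → Adj c d → a ≢ c → a ≢ d → b ≢ c → b ≢ d →
                   3 * length L ≤ 4 * sepCount L a b c d) →
                  PiFracLe4/3 Adj
fractional-≤4/3 {n} Adj L L≢[] three-quarters m _ N =
  3 * Y , N≤3Y , 4 * Y , (L′ , length-L′ , separates-L′) , ratio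
  where
  r X Y : ℕ
  r = suc N
  X = length L
  Y = r * X

  L′ : List (Permutation′ n)
  L′ = concat (replicate (4 * r) L)

  Y>0 : 0 < Y
  Y>0 = *-mono-≤ (s≤s (z≤n {N})) L≢[]

  N≤3Y : N ≤ 3 * Y
  N≤3Y = ≤-trans (n≤1+n N) (≤-trans (subst (_≤ Y) (*-identityʳ r) (*-monoʳ-≤ r L≢[])) (m≤n*m Y 3))

  length-L′ : length L′ ≡ 4 * Y
  length-L′ = begin
    length L′                        ≡⟨ count-true L′ ⟨
    count (λ _ → true) L′            ≡⟨ count-concat-replicate (λ _ → true) (4 * r) L ⟩
    4 * r * count (λ _ → true) L     ≡⟨ cong (4 * r *_) (count-true L) ⟩
    4 * r * X                        ≡⟨ *-assoc 4 r X ⟩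
    4 * Y                            ∎
    where open ≡-Reasoning

  separates-L′ : SeparatesAll Adj (3 * Y) L′
  separates-L′ a b c d ab cd a≢c a≢d b≢c b≢d = begin
    3 * (r * X)                ≡⟨ regroup₃ r X ⟩
    r * (3 * X)                ≤⟨ *-monoʳ-≤ r (three-quarters a b c d ab cd a≢c a≢d b≢c b≢d) ⟩
    r * (4 * sepCount L a b c d) ≡⟨ regroup₄ r (sepCount L a b c d) ⟩
    4 * r * sepCount L a b c d ≡⟨ cong (4 * r *_) (sepCount≡count L a b c d) ⟩
    4 * r * count separating L ≡⟨ count-concat-replicate separating (4 * r) L ⟨
    count separating L′        ≡⟨ sepCount≡count L′ a b c d ⟨
    sepCount L′ a b c d        ∎
    where
    open ≤-Reasoning
    separating : Permutation′ n → Bool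
    separating σ = separates σ a b c d
    regroup₃ : ∀ r X → 3 * (r * X) ≡ r * (3 * X)
    regroup₃ = solve-∀
    regroup₄ : ∀ r s → r * (4 * s) ≡ 4 * r * s
    regroup₄ = solve-∀

  ratio : 3 * m * (4 * Y) < (4 * m + 3) * (3 * Y)
  ratio = subst (3 * m * (4 * Y) <_) (sym (expand m Y)) (m<m+n (3 * m * (4 * Y)) (≤-trans Y>0 (m≤n*m Y 9)))
    where
    expand : ∀ m Y → (4 * m + 3) * (3 * Y) ≡ 3 * m * (4 * Y) + 9 * Y
    expand = solve-∀

bounded : ∀ {k} (f : Fin k → ℕ) → ∃[ B ] (∀ i → f i ≤ B)
bounded {zero}  f = 0 , λ ()
bounded {suc k} f with B , f∘suc≤B ← bounded (f ∘ suc) =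
  f zero ⊔ B , λ { zero → m≤m⊔n (f zero) B ; (suc i) → m≤n⇒m≤o⊔n (f zero) (f∘suc≤B i) }

module Spider (k : ℕ) (legs pend : Fin k → ℕ) where

  V : Set
  V = SV k legs pend

  depth : V → ℕ
  depth centre        = 0
  depth (leg i j)     = suc (toℕ j)
  depth (pendant i _) = suc (suc (legs i))

  depth< : ∀ {B} → (∀ i → legs i ≤ B) → ∀ x → depth x < 3 + B
  depth< legs≤B centre        = z<s
  depth< legs≤B (leg i j)     = s≤s (s≤s (≤-trans (toℕ≤pred[n] j) (m≤n⇒m≤1+n (legs≤B i))))
  depth< legs≤B (pendant i _) = s≤s (s≤s (s≤s (legs≤B i)))

  data OnLeg (i : Fin k) : V → Set where
    leg     : (j : Fin (suc (legs i))) → OnLeg i (leg i j)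
    pendant : (q : Fin (pend i)) → OnLeg i (pendant i q)

  leg-depth-injective : ∀ {i y} (p : Fin (suc (legs i))) → OnLeg i y → depth y ≡ depth (leg i p) → y ≡ leg i p
  leg-depth-injective p (leg j)     eq = cong (leg _) (toℕ-injective (suc-injective eq))
  leg-depth-injective p (pendant q) eq = ⊥-elim (<-irrefl (sym eq) (s≤s (s≤s (toℕ≤pred[n] p))))

  data Along (i : Fin k) : V → V → Set where
    spoke : Along i centre (leg i zero)
    outer : (p : Fin (suc (legs i))) {y : V} → OnLeg i y → depth y ≡ suc (depth (leg i p)) →
            Along i (leg i p) y

  along : ∀ {x y} → Step k legs pend x y → ∃[ i ] Along i x y
  along (centre-leg i)  = i , spoke
  along (leg-leg i j)   = i , outer (inject₁ j) (leg (suc j)) (cong (2 +_) (sym (toℕ-inject₁ j)))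
  along (leg-pend i q)  = i , outer (fromℕ (legs i)) (pendant q) (cong (2 +_) (sym (toℕ-fromℕ (legs i))))

  along-target : ∀ {i x y} → Along i x y → OnLeg i y
  along-target spoke            = leg zero
  along-target (outer _ y-on _) = y-on

  along-depth : ∀ {i x y} → Along i x y → depth y ≡ suc (depth x)
  along-depth spoke          = refl
  along-depth (outer _ _ eq) = eq

  along-source-injective : ∀ {i x y z w} → Along i x y → Along i z w → depth x ≡ depth z → x ≡ z
  along-source-injective spoke           spoke           _  = refl
  along-source-injective (outer p _ _)   (outer p′ _ _)  eq = cong (leg _) (toℕ-injective (suc-injective eq))

  module Ordering (W : ℕ) (depth<W : ∀ x → depth x < W) where

    slot : Bool → Fin k → ℕ
    slot true  i = k + suc (toℕ i)
    slot false i = toℕ i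

    slot-injective : ∀ b b′ {i j} → slot b i ≡ slot b′ j → i ≡ j
    slot-injective true  true        eq = toℕ-injective (suc-injective (+-cancelˡ-≡ k _ _ eq))
    slot-injective false false       eq = toℕ-injective eq
    slot-injective true  false {j = j} eq = ⊥-elim (<-irrefl (sym eq) (<-≤-trans (toℕ<n j) (m≤m+n k _)))
    slot-injective false true  {i}   eq = ⊥-elim (<-irrefl eq (<-≤-trans (toℕ<n i) (m≤m+n k _)))

    slotOf : Vector Bool k → V → ℕ
    slotOf s centre        = k
    slotOf s (leg i _)     = slot (s i) i
    slotOf s (pendant i _) = slot (s i) i

    inner : Bool → ℕ → ℕ
    inner true  d = d
    inner false d = W ∸ suc d

    within : Vector Bool k → V → ℕ
    within s centre            = 0
    within s x@(leg i _)       = inner (s i) (depth x)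
    within s x@(pendant i _)   = inner (s i) (depth x)

    -- lexicographic in (slotOf s x, within s x), as within s x < W
    key : Vector Bool k → V → ℕ
    key s x = slotOf s x * W + within s x

    slotOf-onLeg : ∀ s {i x} → OnLeg i x → slotOf s x ≡ slot (s i) i
    slotOf-onLeg s (leg _)     = refl
    slotOf-onLeg s (pendant _) = refl

    key-onLeg : ∀ s {i x} → OnLeg i x → key s x ≡ slot (s i) i * W + inner (s i) (depth x)
    key-onLeg s (leg _)     = refl
    key-onLeg s (pendant _) = refl

    inner-< : ∀ b {d} → d < W → inner b d < W
    inner-< true  d<W = d<W
    inner-< false d<W = ∸-monoʳ-< z<s d<W

    within-< : ∀ s x → within s x < W
    within-< s centre          = depth<W centre
    within-< s x@(leg i _)     = inner-< (s i) (depth<W x)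
    within-< s x@(pendant i _) = inner-< (s i) (depth<W x)

    key-<-slot : ∀ s x y → slotOf s x < slotOf s y → key s x < key s y
    key-<-slot s x y lt = begin-strict
      slotOf s x * W + within s x  <⟨ +-monoʳ-< (slotOf s x * W) (within-< s x) ⟩
      slotOf s x * W + W           ≡⟨ +-comm (slotOf s x * W) W ⟩
      suc (slotOf s x) * W         ≤⟨ *-monoˡ-≤ W lt ⟩
      slotOf s y * W               ≤⟨ m≤m+n (slotOf s y * W) (within s y) ⟩
      slotOf s y * W + within s y  ∎
      where open ≤-Reasoning

    key-<-onLeg : ∀ s x {j v} → OnLeg j v → slotOf s x < slot (s j) j → key s x < key s v
    key-<-onLeg s x {v = v} v-on lt = key-<-slot s x v (subst (_ <_) (sym (slotOf-onLeg s v-on)) lt)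

    key-onLeg-< : ∀ s x {j v} → OnLeg j v → slot (s j) j < slotOf s x → key s v < key s x
    key-onLeg-< s x {v = v} v-on lt = key-<-slot s v x (subst (_< _) (sym (slotOf-onLeg s v-on)) lt)

    key-<-across-legs : ∀ s {i j u v} → OnLeg i u → OnLeg j v → slot (s i) i < slot (s j) j → key s u < key s v
    key-<-across-legs s {u = u} u-on v-on lt = key-<-onLeg s u v-on (subst (_< _) (sym (slotOf-onLeg s u-on)) lt)

    inner-oriented : ∀ b {d d′} → d < d′ → d′ < W → Oriented b (inner b d) (inner b d′)
    inner-oriented true  d<d′ _    = d<d′
    inner-oriented false d<d′ d′<W = ∸-monoʳ-< (s≤s d<d′) d′<W

    oriented-along : ∀ s {i x z} → OnLeg i x → OnLeg i z → depth x < depth z → Oriented (s i) (key s x) (key s z)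
    oriented-along s {i} {z = z} x-on z-on dx<dz rewrite key-onLeg s x-on | key-onLeg s z-on =
      Oriented-+ (s i) (slot (s i) i * W) (inner-oriented (s i) dx<dz (depth<W z))

    oriented-centre : ∀ s {i z} → OnLeg i z → Oriented (s i) (key s centre) (key s z)
    oriented-centre s {i} {z} z-on with s i | slotOf-onLeg s z-on
    ... | true  | eq = key-<-slot s centre z (subst (k <_) (sym eq) (m<m+n k z<s))
    ... | false | eq = key-<-slot s z centre (subst (_< k) (sym eq) (toℕ<n i))

    oriented-source : ∀ s {i x y v} → Along i x y → OnLeg i v → depth x < depth v →
                      Oriented (s i) (key s x) (key s v)
    oriented-source s spoke         v-on _     = oriented-centre s v-on
    oriented-source s (outer p _ _) v-on dx<dv = oriented-along s (leg p) v-on dx<dv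

    deeper-separated : ∀ s {i x y z w} → Along i x y → Along i z w → depth x < depth z → y ≢ z →
                       Separated (key s) x y z w
    deeper-separated s {i} {x} {y} {w = w} e (outer p w-on dw) dx<dz y≢z =
      separated-oriented (s i) (oriented-source s e (leg p) dx<dz) (oriented-source s e w-on dx<dw)
                               (oriented-along s y-on (leg p) dy<dz) (oriented-along s y-on w-on dy<dw)
      where
      y-on : OnLeg i y
      y-on = along-target e

      dz<dw : depth (leg i p) < depth w
      dz<dw = subst (depth (leg i p) <_) (sym dw) (n<1+n _)

      dy<dz : depth y < depth (leg i p)
      dy<dz = ≤∧≢⇒< (subst (_≤ depth (leg i p)) (sym (along-depth e)) dx<dz)
                    (y≢z ∘ leg-depth-injective p y-on)

      dx<dw : depth x < depth w
      dx<dw = <-trans dx<dz dz<dw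

      dy<dw : depth y < depth w
      dy<dw = <-trans dy<dz dz<dw

    same-leg-separated : ∀ s {i x y z w} → Along i x y → Along i z w → x ≢ z → x ≢ w → y ≢ z →
                         Separated (key s) x y z w
    same-leg-separated s {x = x} {z = z} e f x≢z x≢w y≢z with <-cmp (depth x) (depth z)
    ... | tri< dx<dz _ _ = deeper-separated s e f dx<dz y≢z
    ... | tri≈ _ dx≡dz _ = ⊥-elim (x≢z (along-source-injective e f dx≡dz))
    ... | tri> _ _ dz<dx = Separated-sym (deeper-separated s f e dz<dx (≢-sym x≢w))

    separated-different-legs : ∀ s {i j x y z w} → i ≢ j → OnLeg i x → OnLeg i y → OnLeg j z → OnLeg j w →
                               Separated (key s) x y z w
    separated-different-legs s {i} {j} i≢j x-on y-on z-on w-on with <-cmp (slot (s i) i) (slot (s j) j)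
    ... | tri< lt _ _ = ahead  (below (key-<-across-legs s x-on z-on lt) (key-<-across-legs s x-on w-on lt)
                                      (key-<-across-legs s y-on z-on lt) (key-<-across-legs s y-on w-on lt))
    ... | tri≈ _ eq _ = ⊥-elim (i≢j (slot-injective (s i) (s j) eq))
    ... | tri> _ _ gt = behind (below (key-<-across-legs s z-on x-on gt) (key-<-across-legs s z-on y-on gt)
                                      (key-<-across-legs s w-on x-on gt) (key-<-across-legs s w-on y-on gt))

    -- False exactly when legs i and j lie on the same side of the centre with leg j between
    -- the centre and leg i.
    spoke-good : Fin k → Fin k → Vector Bool k → Bool
    spoke-good i j s = (s i xor (toℕ j <ᵇ toℕ i)) ∨ (s j xor (toℕ j <ᵇ toℕ i))

    spoke-clear : ∀ {i j} bi bj → i ≢ j → T ((bi xor (toℕ j <ᵇ toℕ i)) ∨ (bj xor (toℕ j <ᵇ toℕ i))) →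
                  (k < slot bj j × slot bi i < slot bj j) ⊎ (slot bj j < k × slot bj j < slot bi i)
    spoke-clear {i} {j} false true  _ _ = inj₁ (m<m+n k z<s , <-≤-trans (toℕ<n i) (m≤m+n k _))
    spoke-clear {i} {j} true  false _ _ = inj₂ (toℕ<n j , <-≤-trans (toℕ<n j) (m≤m+n k _))
    spoke-clear {i} {j} true  true  i≢j good with toℕ j <ᵇ toℕ i | <ᵇ-reflects-< (toℕ j) (toℕ i)
    ... | false | ofⁿ j≮i =
      inj₁ (m<m+n k z<s , +-monoʳ-< k (s≤s (≤∧≢⇒< (≮⇒≥ j≮i) (i≢j ∘ toℕ-injective))))
    ... | true  | _       = ⊥-elim good
    spoke-clear {i} {j} false false _   good with toℕ j <ᵇ toℕ i | <ᵇ-reflects-< (toℕ j) (toℕ i)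
    ... | true  | ofʸ j<i = inj₂ (toℕ<n j , j<i)
    ... | false | _       = ⊥-elim good

    spoke-separated : ∀ s {i j z w} → i ≢ j → OnLeg j z → OnLeg j w → T (spoke-good i j s) →
                      Separated (key s) centre (leg i zero) z w
    spoke-separated s {i} {j} i≢j z-on w-on good with spoke-clear (s i) (s j) i≢j good
    ... | inj₁ (k<j , i<j) =
      ahead (below (key-<-onLeg s centre z-on k<j) (key-<-onLeg s centre w-on k<j)
                   (key-<-onLeg s (leg i zero) z-on i<j) (key-<-onLeg s (leg i zero) w-on i<j))
    ... | inj₂ (j<k , j<i) =
      behind (below (key-onLeg-< s centre z-on j<k) (key-onLeg-< s (leg i zero) z-on j<i)
                    (key-onLeg-< s centre w-on j<k) (key-onLeg-< s (leg i zero) w-on j<i))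

    Separable : V → V → V → V → Set
    Separable x y z w = Σ (Vector Bool k → Bool) λ good →
                        ThreeQuarters good × (∀ s → T (good s) → Separated (key s) x y z w)

    Separable-map : ∀ {x y z w x′ y′ z′ w′} →
                    (∀ {κ : V → ℕ} → Separated κ x y z w → Separated κ x′ y′ z′ w′) →
                    Separable x y z w → Separable x′ y′ z′ w′
    Separable-map f (good , large , separated) = good , large , λ s good-s → f (separated s good-s)

    separable-always : ∀ {x y z w} → (∀ s → Separated (key s) x y z w) → Separable x y z w
    separable-always separated = (λ _ → true) , ThreeQuarters-all {k} , λ s _ → separated s

    spoke-separable : ∀ {i j z w} → i ≢ j → OnLeg j z → OnLeg j w → Separable centre (leg i zero) z w
    spoke-separable {i} {j} i≢j z-on w-on =
      spoke-good i j , ThreeQuarters-two-coordinates i≢j (toℕ j <ᵇ toℕ i) (toℕ j <ᵇ toℕ i) ,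
      λ s → spoke-separated s i≢j z-on w-on

    different-legs-separable : ∀ {i j x y z w} → i ≢ j → Along i x y → Along j z w → x ≢ z →
                               Separable x y z w
    different-legs-separable i≢j spoke            spoke            x≢z = ⊥-elim (x≢z refl)
    different-legs-separable i≢j spoke            (outer p w-on _) _   = spoke-separable i≢j (leg p) w-on
    different-legs-separable i≢j (outer p y-on _) spoke            _   =
      Separable-map Separated-sym (spoke-separable (≢-sym i≢j) (leg p) y-on)
    different-legs-separable i≢j (outer p y-on _) (outer q w-on _) _   =
      separable-always λ s → separated-different-legs s i≢j (leg p) y-on (leg q) w-on

    along-separable : ∀ {i j x y z w} → Along i x y → Along j z w → x ≢ z → x ≢ w → y ≢ z →
                      Separable x y z w
    along-separable {i} {j} e f x≢z x≢w y≢z with i ≟ j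
    ... | yes refl = separable-always λ s → same-leg-separated s e f x≢z x≢w y≢z
    ... | no i≢j   = different-legs-separable i≢j e f x≢z

    step-separable : ∀ {x y z w} → Step k legs pend x y → Step k legs pend z w → x ≢ z → x ≢ w → y ≢ z →
                     Separable x y z w
    step-separable e f = along-separable (proj₂ (along e)) (proj₂ (along f))

    separable : ∀ {x y z w} → SAdj k legs pend x y → SAdj k legs pend z w →
                x ≢ z → x ≢ w → y ≢ z → y ≢ w → Separable x y z w
    separable (inj₁ e) (inj₁ f) x≢z x≢w y≢z _   = step-separable e f x≢z x≢w y≢z
    separable (inj₂ e) (inj₁ f) x≢z x≢w y≢z y≢w =
      Separable-map Separated-swapˡ (step-separable e f y≢z y≢w x≢z)
    separable (inj₁ e) (inj₂ f) x≢z x≢w y≢z y≢w =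
      Separable-map Separated-swapʳ (step-separable e f x≢w x≢z y≢w)
    separable (inj₂ e) (inj₂ f) x≢z x≢w y≢z y≢w =
      Separable-map (Separated-swapˡ ∘ Separated-swapʳ) (step-separable e f y≢w y≢z x≢w)

    module Embedded {n} (Adj : Fin n → Fin n → Set) (g : Fin n → V) (g-injective : Injective _≡_ _≡_ g)
                    (g-edge : ∀ {a b} → Adj a b → SAdj k legs pend (g a) (g b)) where

      σ : Vector Bool k → Permutation′ n
      σ s = sortBy (key s ∘ g)

      orderings : List (Permutation′ n)
      orderings = map σ (signs k)

      length-orderings : length orderings ≡ 2 ^ k
      length-orderings = trans (length-map σ (signs k)) (length-signs k)

      g≢ : ∀ {a b} → a ≢ b → g a ≢ g b
      g≢ a≢b = a≢b ∘ g-injective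

      separable⇒three-quarters : ∀ {a b c d} → Separable (g a) (g b) (g c) (g d) →
                                 3 * length orderings ≤ 4 * sepCount orderings a b c d
      separable⇒three-quarters {a} {b} {c} {d} (good , large , separated) = begin
        3 * length orderings            ≡⟨ cong (3 *_) length-orderings ⟩
        3 * 2 ^ k                       ≤⟨ large ⟩
        4 * count good (signs k)        ≤⟨ *-monoʳ-≤ 4 (count≤sepCount σ good⇒separates (signs k)) ⟩
        4 * sepCount orderings a b c d  ∎
        where
        open ≤-Reasoning
        good⇒separates : ∀ s → T (good s) → T (separates (σ s) a b c d)
        good⇒separates s good-s =
          separates-if-separated {σ = σ s} (sortBy-orders (key s ∘ g)) (Separated-∘ g (separated s good-s))

      three-quarters : ∀ a b c d → Adj a b → Adj c d → a ≢ c → a ≢ d → b ≢ c → b ≢ d →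
                       3 * length orderings ≤ 4 * sepCount orderings a b c d
      three-quarters a b c d ab cd a≢c a≢d b≢c b≢d =
        separable⇒three-quarters (separable (g-edge ab) (g-edge cd) (g≢ a≢c) (g≢ a≢d) (g≢ b≢c) (g≢ b≢d))

mainTheorem8 : (n : ℕ) (Adj : Fin n → Fin n → Set)
               (k : ℕ) (legs pend : Fin k → ℕ) →
               IsoToSpider Adj k legs pend →
               PiFracLe4/3 Adj
mainTheorem8 n Adj k legs pend (f , adj⇔) =
  fractional-≤4/3 Adj orderings (subst (0 <_) (sym length-orderings) (m^n>0 2 k)) three-quarters
  where
  open Spider k legs pend
  open Ordering (3 + proj₁ (bounded legs)) (depth< (proj₂ (bounded legs)))
  open Embedded Adj (Inverse.to f) (Injection.injective (↔⇒↣ f)) (λ {a} {b} → Equivalence.to (adj⇔ a b))
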